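{- Let $v$ be a node of a standard graph $G$ with $l:=\ell_G(v)\ge1$, and let $k$ be the number of standard components of $G$ that give $v$ the label $1$. Then the number of standard $v$-decompositions of $G$ is at least $k/l$ and at most $\binom{k+l-1}{l}$. If moreover $v$ is a node of minimal positive label in $G$, then there are at least $k$ standard $v$-decompositions of $G$.
   Context: A labeled graph $G$: finite node set, directed edges without loops, integer labeling $\ell_G$. $G$ is standard if labels are $\ge0$ and $\ell_G(a)\le\ell_G(b)$ for each edge $(a,b)$. For graphs with the same nodes and edges, $\oplus,\ominus$ add/subtract labels nodewise; $\sum$ denotes sum of a multiset. A standard component of $G$ is a labeled graph $H$ with the same nodes and edges as $G$, labels in $\{0,1\}$, $H$ standard, $G\ominus H$ standard, not all labels of $H$ zero. A standard $v$-decomposition of $G$ is a finite multiset $\mathcal H$ of standard components of $G$ each giving $v$ label $1$, with $G\ominus\sum\mathcal H$ standard and $|\mathcal H|=\ell_G(v)$. -}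

module Defs where

open import Data.Nat using (ℕ; zero; suc)
open import Data.Bool using (Bool; true; false)
open import Data.Integer using (ℤ; +_; _+_; _-_; _≤_; _<_; _≤?_)
open import Data.Fin using (Fin)
open import Data.Fin.Properties using (all?; any?)
open import Data.Vec using (Vec; []; _∷_; lookup)
open import Data.List using (List; []; _∷_; map; _++_; filter; length; [_]; foldr)
open import Data.List.Relation.Unary.All as All using (All)
open import Data.Product using (_×_; _,_; proj₁; proj₂; ∃)
open import Relation.Binary.PropositionalEquality using (_≡_; _≢_)
open import Relation.Nullary using (Dec; yes; no; ¬_)
open import Relation.Nullary.Decidable using (_×-dec_)
open import Data.Bool.Properties using () renaming (_≟_ to _≟B_)

record LGraph (n : ℕ) : Set where
  constructor mkLGraph
  field
    edges  : List (Fin n × Fin n)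
    label  : Fin n → ℤ

open LGraph public

Loopless : ∀ {n} → List (Fin n × Fin n) → Set
Loopless E = All (λ e → proj₁ e ≢ proj₂ e) E

Standard : ∀ {n} → List (Fin n × Fin n) → (Fin n → ℤ) → Set
Standard E ℓ = (∀ i → + 0 ≤ ℓ i) × All (λ e → ℓ (proj₁ e) ≤ ℓ (proj₂ e)) E

standard? : ∀ {n} (E : List (Fin n × Fin n)) (ℓ : Fin n → ℤ) → Dec (Standard E ℓ)
standard? E ℓ = all? (λ i → + 0 ≤? ℓ i) ×-dec All.all? (λ e → ℓ (proj₁ e) ≤? ℓ (proj₂ e)) E

_⊕_ : ∀ {n} → (Fin n → ℤ) → (Fin n → ℤ) → (Fin n → ℤ)
(f ⊕ g) i = f i + g i

_⊖_ : ∀ {n} → (Fin n → ℤ) → (Fin n → ℤ) → (Fin n → ℤ)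
(f ⊖ g) i = f i - g i

-- A {0,1}-labeling, encoded as a Bool vector, and its integer labeling.
bit : Bool → ℤ
bit true  = + 1
bit false = + 0

labelOf : ∀ {n} → Vec Bool n → (Fin n → ℤ)
labelOf H i = bit (lookup H i)

zeroL : ∀ {n} → Fin n → ℤ
zeroL _ = + 0

sumL : ∀ {n} → List (Vec Bool n) → (Fin n → ℤ)
sumL = foldr (λ H acc → labelOf H ⊕ acc) zeroL

StandardComponent : ∀ {n} → LGraph n → Vec Bool n → Set
StandardComponent G H =
  Standard (edges G) (labelOf H)
  × Standard (edges G) (label G ⊖ labelOf H)
  × ∃ (λ i → lookup H i ≡ true)

stdComp? : ∀ {n} (G : LGraph n) (H : Vec Bool n) → Dec (StandardComponent G H)
stdComp? G H = standard? (edges G) (labelOf H)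
  ×-dec (standard? (edges G) (label G ⊖ labelOf H)
  ×-dec any? (λ i → lookup H i ≟B true))

VComponent : ∀ {n} → LGraph n → Fin n → Vec Bool n → Set
VComponent G v H = StandardComponent G H × lookup H v ≡ true

vComp? : ∀ {n} (G : LGraph n) (v : Fin n) (H : Vec Bool n) → Dec (VComponent G v H)
vComp? G v H = stdComp? G H ×-dec (lookup H v ≟B true)

allBoolVecs : (n : ℕ) → List (Vec Bool n)
allBoolVecs zero = [ [] ]
allBoolVecs (suc n) = map (true ∷_) (allBoolVecs n) ++ map (false ∷_) (allBoolVecs n)

vComponents : ∀ {n} → LGraph n → Fin n → List (Vec Bool n)
vComponents G v = filter (vComp? G v) (allBoolVecs n)
  where n = _

numVComponents : ∀ {n} → LGraph n → Fin n → ℕ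
numVComponents G v = length (vComponents G v)

-- All multisets of size k with elements from the list xs: each multiset is
-- listed exactly once (if xs has no repetitions), represented as a list whose
-- elements appear in the order of xs.
multisets : ∀ {A : Set} → ℕ → List A → List (List A)
multisets zero    _        = [ [] ]
multisets (suc k) []       = []
multisets (suc k) (x ∷ xs) = map (x ∷_) (multisets k (x ∷ xs)) ++ multisets (suc k) xs

-- A multiset 𝓗 (of size ℓ_G(v), of standard components giving v label 1)
-- is a standard v-decomposition iff G ⊖ Σ𝓗 is standard.
DecompCond : ∀ {n} → LGraph n → List (Vec Bool n) → Set
DecompCond G 𝓗 = Standard (edges G) (label G ⊖ sumL 𝓗)

decompCond? : ∀ {n} (G : LGraph n) (𝓗 : List (Vec Bool n)) → Dec (DecompCond G 𝓗)
decompCond? G 𝓗 = standard? (edges G) (label G ⊖ sumL 𝓗)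

-- Number of standard v-decompositions of G, for l = ℓ_G(v) (as a natural).
numVDecompositions : ∀ {n} → LGraph n → Fin n → ℕ → ℕ
numVDecompositions G v l = length (filter (decompCond? G) (multisets l (vComponents G v)))

MinPositive : ∀ {n} → LGraph n → Fin n → Set
MinPositive G v = + 0 < label G v × (∀ u → + 0 < label G u → label G v ≤ label G u)

module Submission where

-- Proposition 5.2.  Write l = ℓ_G(v) = suc m, k for the number of standard
-- components giving v label 1 and d for the number of v-decompositions.
--
-- Peeling: if F and G ⊖ F are standard, the support of F is a standard
-- component of G and F ⊖ supp F is again such a layer of G; peeling F(v)
-- times gives F(v) components giving v label 1.  So every component H has a
-- completion H ∷ peel (G ⊖ H) m, a v-decomposition containing H once sorted
-- into the canonical enumeration of multisets.  Hence the k components are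
-- covered by d decompositions of size l, giving k ≤ l · d; and d ≤ (k + m)
-- choose l, the number of multisets of size l over k components.  If v has
-- minimal positive label, G ⊖ H is m-flat (zero, or at least m, everywhere),
-- so its peeling is m copies of supp G and the completion determines H: k ≤ d.

open import Defs
open import Data.Nat using (ℕ; _≤_; _*_; _+_; _∸_)
open import Data.Nat.Combinatorics using (_C_)
open import Data.Integer using (+_)
open import Data.Fin using (Fin)
open import Data.Product using (_×_)
open import Relation.Binary.PropositionalEquality using (_≡_)

open import Data.Nat using (zero; suc; z≤n; s≤s)
import Data.Nat.Properties as ℕP
open import Data.Nat.Combinatorics using (nCk+nC[k+1]≡[n+1]C[k+1])
open import Data.Nat.Combinatorics.Specification using (k>n⇒nCk≡0)
open import Data.Integer using (ℤ; -[1+_]; +≤+; -≤+; +<+)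
  renaming (_+_ to _+ℤ_; _-_ to _-ℤ_; _≤_ to _≤ℤ_; _<_ to _<ℤ_)
import Data.Integer.Properties as ℤP
open import Data.Integer.Tactic.RingSolver using (solve-∀)
open import Data.Bool using (Bool; true; false)
open import Data.Vec using (Vec; []; _∷_; lookup; tabulate)
import Data.Vec.Properties as VecP
open import Data.List using (List; []; _∷_; length; filter; concat; replicate; map; _++_)
import Data.List.Properties as ListP
open import Data.List.Relation.Unary.All as All using (All; []; _∷_)
open import Data.List.Relation.Unary.Any using (here; there)
open import Data.List.Membership.Propositional using (_∈_)
open import Data.List.Membership.Propositional.Properties
  using (∈-++⁺ˡ; ∈-++⁺ʳ; ∈-++⁻; ∈-map⁺; ∈-map⁻; ∈-filter⁺; ∈-filter⁻; ∈-concat⁺′)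
open import Data.List.Relation.Binary.Permutation.Propositional as Perm using (_↭_; ↭-sym)
open import Data.List.Relation.Binary.Permutation.Propositional.Properties using (∈-resp-↭)
open import Data.List.Relation.Unary.Unique.Propositional using (Unique)
import Data.List.Relation.Unary.Unique.Propositional.Properties as UniqueP
open import Data.List.Relation.Unary.AllPairs using ([]; _∷_)
open import Data.Product using (∃; _,_; proj₁; proj₂)
open import Data.Sum using (_⊎_; inj₁; inj₂)
import Data.Sum as Sum
open import Data.Empty using (⊥; ⊥-elim)
open import Function using (_∘_)
open import Relation.Binary.PropositionalEquality
  using (_≗_; refl; sym; trans; cong; cong₂; subst; subst₂; module ≡-Reasoning)

sub-sub : ∀ a b c → (a -ℤ b) -ℤ c ≡ a -ℤ (b +ℤ c)
sub-sub = solve-∀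

sub-via : ∀ g f s → g -ℤ s ≡ (f -ℤ s) +ℤ (g -ℤ f)
sub-via = solve-∀

sub-of-sub : ∀ g f s → g -ℤ (f -ℤ s) ≡ (g -ℤ f) +ℤ s
sub-of-sub = solve-∀

sub-cancel : ∀ g h → h ≡ g -ℤ (g -ℤ h)
sub-cancel = solve-∀

add-left-comm : ∀ a b c → a +ℤ (b +ℤ c) ≡ b +ℤ (a +ℤ c)
add-left-comm = solve-∀

module _ {n : ℕ} {E : List (Fin n × Fin n)} where

  standard-≗ : ∀ {f g : Fin n → ℤ} → f ≗ g → Standard E f → Standard E g
  standard-≗ f≗g (nonneg , mono) =
      (λ i → subst (+ 0 ≤ℤ_) (f≗g i) (nonneg i))
    , All.map (λ {e} → subst₂ _≤ℤ_ (f≗g (proj₁ e)) (f≗g (proj₂ e))) mono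

  standard-⊕ : ∀ {f g : Fin n → ℤ} → Standard E f → Standard E g → Standard E (f ⊕ g)
  standard-⊕ (nonneg-f , mono-f) (nonneg-g , mono-g) =
      (λ i → ℤP.+-mono-≤ (nonneg-f i) (nonneg-g i))
    , All.zipWith (λ (p , q) → ℤP.+-mono-≤ p q) (mono-f , mono-g)

  standard-∘ : ∀ {f : Fin n → ℤ} (φ : ℤ → ℤ) →
    (∀ {a b} → a ≤ℤ b → φ a ≤ℤ φ b) → (∀ {a} → + 0 ≤ℤ a → + 0 ≤ℤ φ a) →
    Standard E f → Standard E (φ ∘ f)
  standard-∘ φ φ-mono φ-nonneg (nonneg , mono) = (λ i → φ-nonneg (nonneg i)) , All.map φ-mono mono

positive : ℤ → Bool
positive (+ suc _) = true
positive _         = false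

step : ℤ → ℤ
step z = bit (positive z)

-- Both the step and the value minus its step are monotone and non-negative
-- on non-negative values; this is what makes supports of standard labelings
-- and their residuals standard.
bit-nonneg : ∀ b → + 0 ≤ℤ bit b
bit-nonneg true  = +≤+ z≤n
bit-nonneg false = +≤+ z≤n

step-mono : ∀ {a b} → a ≤ℤ b → step a ≤ℤ step b
step-mono {+ zero}    {+ _}     _       = bit-nonneg _
step-mono {+ suc _}   {+ suc _} _       = +≤+ (s≤s z≤n)
step-mono {+ suc _}   {+ zero}  (+≤+ ())
step-mono { -[1+ _ ]} {_}       _       = bit-nonneg _

drop-mono : ∀ {a b} → a ≤ℤ b → a -ℤ step a ≤ℤ b -ℤ step b
drop-mono {+ zero}    {+ zero}    _              = +≤+ z≤n
drop-mono {+ zero}    {+ suc _}   _              = +≤+ z≤n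
drop-mono {+ suc _}   {+ suc _}   (+≤+ (s≤s h))  = +≤+ h
drop-mono {+ suc _}   {+ zero}    (+≤+ ())
drop-mono { -[1+ _ ]} {+ zero}    _              = -≤+
drop-mono { -[1+ _ ]} {+ suc _}   _              = -≤+
drop-mono { -[1+ _ ]} { -[1+ _ ]} h              = h

drop-nonneg : ∀ {a} → + 0 ≤ℤ a → + 0 ≤ℤ a -ℤ step a
drop-nonneg {+ zero}  _ = +≤+ z≤n
drop-nonneg {+ suc _} _ = +≤+ z≤n

support : ∀ {n} → (Fin n → ℤ) → Vec Bool n
support F = tabulate (positive ∘ F)

lookup-support : ∀ {n} (F : Fin n → ℤ) i → lookup (support F) i ≡ positive (F i)
lookup-support F = VecP.lookup∘tabulate (positive ∘ F)

support-at : ∀ {n} (F : Fin n → ℤ) {v m} → F v ≡ + suc m → lookup (support F) v ≡ true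
support-at F {v} Fv = trans (lookup-support F v) (cong positive Fv)

remove-at : ∀ {n} (F : Fin n → ℤ) (H : Vec Bool n) {v m} →
  F v ≡ + suc m → lookup H v ≡ true → (F ⊖ labelOf H) v ≡ + m
remove-at F H Fv Hv = cong₂ (λ a b → a -ℤ bit b) Fv Hv

support-standard : ∀ {n E} {F : Fin n → ℤ} → Standard E F → Standard E (labelOf (support F))
support-standard {F = F} sF =
  standard-≗ (λ i → sym (cong bit (lookup-support F i))) (standard-∘ step step-mono (λ _ → bit-nonneg _) sF)

support-residual : ∀ {n E} {F : Fin n → ℤ} → Standard E F → Standard E (F ⊖ labelOf (support F))
support-residual {F = F} sF =
  standard-≗ (λ i → sym (cong (λ b → F i -ℤ bit b) (lookup-support F i)))
             (standard-∘ (λ z → z -ℤ step z) drop-mono drop-nonneg sF)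

peel : ∀ {n} → (Fin n → ℤ) → ℕ → List (Vec Bool n)
peel F zero    = []
peel F (suc m) = support F ∷ peel (F ⊖ labelOf (support F)) m

module Peeling {n} (G : LGraph n) (v : Fin n) where

  private
    E : List (Fin n × Fin n)
    E = edges G

  -- 𝓗 is a list of m standard components of G giving v label 1 whose sum
  -- leaves F standard; for F = ℓ_G and m = ℓ_G(v) this is a listing of a
  -- standard v-decomposition.
  PartialDecomposition : (Fin n → ℤ) → ℕ → List (Vec Bool n) → Set
  PartialDecomposition F m 𝓗 =
    All (VComponent G v) 𝓗 × Standard E (F ⊖ sumL 𝓗) × length 𝓗 ≡ m

  support-component : ∀ {F m} → Standard E F → Standard E (label G ⊖ F) →
    F v ≡ + suc m → VComponent G v (support F)
  support-component {F} sF sGF Fv = (support-standard sF , below , (v , support-at F Fv)) , support-at F Fv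
    where
    below : Standard E (label G ⊖ labelOf (support F))
    below = standard-≗ (λ i → sym (sub-via (label G i) (F i) (labelOf (support F) i)))
                       (standard-⊕ (support-residual sF) sGF)

  cons-decomposition : ∀ F H {m 𝓗} → VComponent G v H →
    PartialDecomposition (F ⊖ labelOf H) m 𝓗 → PartialDecomposition F (suc m) (H ∷ 𝓗)
  cons-decomposition F H {𝓗 = 𝓗} c (components , residual , len) =
    c ∷ components , standard-≗ (λ i → sub-sub (F i) (labelOf H i) (sumL 𝓗 i)) residual , cong suc len

  peel-decomposes : ∀ m {F} → Standard E F → Standard E (label G ⊖ F) → F v ≡ + m →
    PartialDecomposition F m (peel F m)
  peel-decomposes zero    {F} sF _   _  = [] , standard-≗ (λ i → sym (ℤP.+-identityʳ (F i))) sF , refl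
  peel-decomposes (suc m) {F} sF sGF Fv =
    cons-decomposition F (support F) (support-component sF sGF Fv)
      (peel-decomposes m (support-residual sF) below (remove-at F (support F) Fv (support-at F Fv)))
    where
    below : Standard E (label G ⊖ (F ⊖ labelOf (support F)))
    below = standard-≗ (λ i → sym (sub-of-sub (label G i) (F i) (labelOf (support F) i)))
                       (standard-⊕ sGF (support-standard sF))

  completion : ℕ → Vec Bool n → List (Vec Bool n)
  completion m H = H ∷ peel (label G ⊖ labelOf H) m

  completion-decomposes : ∀ {m H} → label G v ≡ + suc m → VComponent G v H →
    PartialDecomposition (label G) (suc m) (completion m H)
  completion-decomposes {m} {H} Gv c@((sH , sGH , _) , Hv) =
    cons-decomposition (label G) H c (peel-decomposes m sGH below (remove-at (label G) H Gv Hv))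
    where
    below : Standard E (label G ⊖ (label G ⊖ labelOf H))
    below = standard-≗ (λ i → sub-cancel (label G i) (labelOf H i)) sH

Flat : ∀ {n} → Vec Bool n → ℕ → (Fin n → ℤ) → Set
Flat S m F = ∀ x → (lookup S x ≡ true × + m ≤ℤ F x) ⊎ (lookup S x ≡ false × F x ≡ + 0)

support-flat : ∀ {n m} {F : Fin n → ℤ} (S : Vec Bool n) → Flat S (suc m) F → support F ≡ S
support-flat {F = F} S flat = trans (VecP.tabulate-cong agree) (VecP.tabulate∘lookup S)
  where
  agree : ∀ x → positive (F x) ≡ lookup S x
  agree x with F x | flat x
  ... | + suc _ | inj₁ (Sx , _) = sym Sx
  ... | + zero  | inj₁ (_ , +≤+ ())
  ... | -[1+ _ ] | inj₁ (_ , ())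
  ... | _       | inj₂ (Sx , refl) = sym Sx

flat-step : ∀ {n m} {F : Fin n → ℤ} (S : Vec Bool n) → Flat S (suc m) F → Flat S m (F ⊖ labelOf S)
flat-step {F = F} S flat x with lookup S x | F x | flat x
... | true  | + suc _  | inj₁ (_ , +≤+ (s≤s h)) = inj₁ (refl , +≤+ h)
... | true  | + zero   | inj₁ (_ , +≤+ ())
... | true  | -[1+ _ ] | inj₁ (_ , ())
... | false | _        | inj₂ (_ , refl) = inj₂ (refl , refl)

peel-flat : ∀ {n} (S : Vec Bool n) m {F : Fin n → ℤ} → Flat S m F → peel F m ≡ replicate m S
peel-flat S zero    _    = refl
peel-flat S (suc m) {F} flat = cong₂ _∷_ (support-flat S flat) (begin
    peel (F ⊖ labelOf (support F)) m  ≡⟨ cong (λ T → peel (F ⊖ labelOf T) m) (support-flat S flat) ⟩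
    peel (F ⊖ labelOf S) m            ≡⟨ peel-flat S m (flat-step S flat) ⟩
    replicate m S                     ∎)
  where open ≡-Reasoning

residual-flat : ∀ {n} (G : LGraph n) (v : Fin n) {m H} → MinPositive G v → label G v ≡ + suc m →
  VComponent G v H → Flat (support (label G)) m (label G ⊖ labelOf H)
residual-flat G v {m} {H} (_ , minimal) Gv ((_ , (nonneg , _) , _) , _) x
  rewrite lookup-support (label G) x =
    pointwise (label G x) (lookup H x) (nonneg x) (λ p → subst (_≤ℤ label G x) Gv (minimal x p))
  where
  -- z = ℓ_G(x) and b = H(x); positive values of G are at least suc m.
  pointwise : ∀ z b → + 0 ≤ℤ z -ℤ bit b → (+ 0 <ℤ z → + suc m ≤ℤ z) →
    (positive z ≡ true × + m ≤ℤ z -ℤ bit b) ⊎ (positive z ≡ false × z -ℤ bit b ≡ + 0)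
  pointwise (+ zero)   false _  _   = inj₂ (refl , refl)
  pointwise (+ suc k)  true  _  min with min (+<+ (s≤s z≤n))
  ... | +≤+ (s≤s h) = inj₁ (refl , +≤+ h)
  pointwise (+ suc k)  false _  min with min (+<+ (s≤s z≤n))
  ... | +≤+ h = inj₁ (refl , +≤+ (ℕP.≤-trans (ℕP.n≤1+n m) (ℕP.≤-trans h (ℕP.m≤m+n (suc k) 0))))
  pointwise (+ zero)   true  () _
  pointwise -[1+ _ ]   true  () _
  pointwise -[1+ _ ]   false () _

module _ {A : Set} where

  multisets-weaken : ∀ {m} (x : A) xs {zs} → zs ∈ multisets m xs → zs ∈ multisets m (x ∷ xs)
  multisets-weaken {zero}  x xs p = p
  multisets-weaken {suc m} x xs p = ∈-++⁺ʳ (map (x ∷_) (multisets m (x ∷ xs))) p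

  multisets-insert : ∀ (xs : List A) m {y} → y ∈ xs → ∀ {zs} → zs ∈ multisets m xs →
    ∃ λ ws → ws ∈ multisets (suc m) xs × ws ↭ (y ∷ zs)
  multisets-insert [] m () _
  multisets-insert (x ∷ xs) zero (here refl) (here refl) = (x ∷ []) , here refl , Perm.refl
  multisets-insert (x ∷ xs) zero (there p) (here refl) with multisets-insert xs zero p (here refl)
  ... | ws , q , r = ws , ∈-++⁺ʳ (map (x ∷_) (multisets zero (x ∷ xs))) q , r
  multisets-insert (x ∷ xs) zero _ (there ())
  multisets-insert (x ∷ xs) (suc m) {y} y∈ zs∈ with ∈-++⁻ (map (x ∷_) (multisets m (x ∷ xs))) zs∈
  ... | inj₁ q with ∈-map⁻ (x ∷_) q
  ...   | zs′ , q′ , refl with y∈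
  ...     | here refl = (x ∷ x ∷ zs′) , ∈-++⁺ˡ (∈-map⁺ (x ∷_) zs∈) , Perm.refl
  ...     | there p with multisets-insert (x ∷ xs) m (there p) q′
  ...       | ws , wq , wr =
    (x ∷ ws) , ∈-++⁺ˡ (∈-map⁺ (x ∷_) wq) , Perm.trans (Perm.prep x wr) (Perm.swap x y Perm.refl)
  multisets-insert (x ∷ xs) (suc m) {y} y∈ {zs} zs∈ | inj₂ q with y∈
  ...   | here refl = (x ∷ zs) , ∈-++⁺ˡ (∈-map⁺ (x ∷_) (multisets-weaken {suc m} x xs q)) , Perm.refl
  ...   | there p with multisets-insert xs (suc m) p q
  ...     | ws , wq , wr = ws , ∈-++⁺ʳ (map (x ∷_) (multisets (suc m) (x ∷ xs))) wq , wr

  multisets-sort : ∀ (xs : List A) ys → All (_∈ xs) ys →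
    ∃ λ zs → zs ∈ multisets (length ys) xs × zs ↭ ys
  multisets-sort xs [] [] = [] , here refl , Perm.refl
  multisets-sort xs (y ∷ ys) (p ∷ ps) with multisets-sort xs ys ps
  ... | zs , q , r with multisets-insert xs (length ys) p q
  ...   | ws , wq , wr = ws , wq , Perm.trans wr (Perm.prep y r)

  multisets-length : ∀ m (xs : List A) {zs} → zs ∈ multisets m xs → length zs ≡ m
  multisets-length zero xs (here refl) = refl
  multisets-length (suc m) (x ∷ xs) p with ∈-++⁻ (map (x ∷_) (multisets m (x ∷ xs))) p
  ... | inj₁ q with ∈-map⁻ (x ∷_) q
  ...   | zs′ , q′ , refl = cong suc (multisets-length m (x ∷ xs) q′)
  multisets-length (suc m) (x ∷ xs) p | inj₂ q = multisets-length (suc m) xs q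

  multisets-count : ∀ m (xs : List A) → length (multisets m xs) ≡ (length xs + (m ∸ 1)) C m
  multisets-count zero xs = refl
  multisets-count (suc m) [] = sym (k>n⇒nCk≡0 (ℕP.n<1+n m))
  multisets-count (suc m) (x ∷ xs) = begin
    length (map (x ∷_) (multisets m (x ∷ xs)) ++ multisets (suc m) xs)
      ≡⟨ ListP.length-++ (map (x ∷_) (multisets m (x ∷ xs))) ⟩
    length (map (x ∷_) (multisets m (x ∷ xs))) + length (multisets (suc m) xs)
      ≡⟨ cong₂ _+_ (ListP.length-map (x ∷_) (multisets m (x ∷ xs))) (multisets-count (suc m) xs) ⟩
    length (multisets m (x ∷ xs)) + (length xs + m) C suc m
      ≡⟨ cong (_+ (length xs + m) C suc m) (trans (multisets-count m (x ∷ xs)) (shift m)) ⟩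
    (length xs + m) C m + (length xs + m) C suc m
      ≡⟨ nCk+nC[k+1]≡[n+1]C[k+1] (length xs + m) m ⟩
    suc (length xs + m) C suc m ∎
    where
    open ≡-Reasoning
    shift : ∀ m → (suc (length xs) + (m ∸ 1)) C m ≡ (length xs + m) C m
    shift zero    = refl
    shift (suc m) = cong (_C suc m) (sym (ℕP.+-suc (length xs) m))

sumL-↭ : ∀ {n} {ys zs : List (Vec Bool n)} → ys ↭ zs → sumL ys ≗ sumL zs
sumL-↭ Perm.refl          i = refl
sumL-↭ (Perm.prep x p)    i = cong (labelOf x i +ℤ_) (sumL-↭ p i)
sumL-↭ (Perm.swap x y p)  i =
  trans (add-left-comm (labelOf x i) (labelOf y i) _)
        (cong (λ t → labelOf y i +ℤ (labelOf x i +ℤ t)) (sumL-↭ p i))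
sumL-↭ (Perm.trans p q)   i = trans (sumL-↭ p i) (sumL-↭ q i)

delete-member : ∀ {A : Set} {y : A} {ys} → y ∈ ys →
  ∃ λ ys′ → length ys ≡ suc (length ys′) × (∀ {z} → z ∈ ys → z ≡ y ⊎ z ∈ ys′)
delete-member (here refl) = _ , refl , λ { (here e) → inj₁ e ; (there q) → inj₂ q }
delete-member {ys = w ∷ _} (there p) with delete-member p
... | ys′ , len , split =
  (w ∷ ys′) , cong suc len , λ { (here e) → inj₂ (here e) ; (there q) → Sum.map₂ there (split q) }

injection-length : ∀ {A B : Set} (R : A → B → Set) (xs : List A) (ys : List B) → Unique xs →
  (∀ {x} → x ∈ xs → ∃ λ y → y ∈ ys × R x y) → (∀ {x x′ y} → R x y → R x′ y → x ≡ x′) →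
  length xs ≤ length ys
injection-length R [] ys _ _ _ = z≤n
injection-length R (x ∷ xs) ys (x∉xs ∷ unique) total injective with total (here refl)
... | y , y∈ys , xRy with delete-member y∈ys
...   | ys′ , len , split =
  subst (suc (length xs) ≤_) (sym len) (s≤s (injection-length R xs ys′ unique total′ injective))
  where
  total′ : ∀ {x′} → x′ ∈ xs → ∃ λ y′ → y′ ∈ ys′ × R x′ y′
  total′ p with total (there p)
  ... | y′ , y′∈ys , x′Ry′ with split y′∈ys
  ...   | inj₁ refl = ⊥-elim (All.lookup x∉xs p (sym (injective x′Ry′ xRy)))
  ...   | inj₂ q    = y′ , q , x′Ry′

length-concat : ∀ {A : Set} l (xss : List (List A)) → (∀ {zs} → zs ∈ xss → length zs ≡ l) →
  length (concat xss) ≡ length xss * l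
length-concat l []         _   = refl
length-concat l (zs ∷ xss) len =
  trans (ListP.length-++ zs) (cong₂ _+_ (len (here refl)) (length-concat l xss (len ∘ there)))

∈-replicate : ∀ {A : Set} {x y : A} m → x ∈ replicate m y → x ≡ y
∈-replicate (suc m) (here e)  = e
∈-replicate (suc m) (there p) = ∈-replicate m p

allBoolVecs-complete : ∀ n (H : Vec Bool n) → H ∈ allBoolVecs n
allBoolVecs-complete zero    []          = here refl
allBoolVecs-complete (suc n) (true ∷ H)  = ∈-++⁺ˡ (∈-map⁺ (true ∷_) (allBoolVecs-complete n H))
allBoolVecs-complete (suc n) (false ∷ H) =
  ∈-++⁺ʳ (map (true ∷_) (allBoolVecs n)) (∈-map⁺ (false ∷_) (allBoolVecs-complete n H))

allBoolVecs-unique : ∀ n → Unique (allBoolVecs n)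
allBoolVecs-unique zero    = [] ∷ []
allBoolVecs-unique (suc n) =
  UniqueP.++⁺ (UniqueP.map⁺ VecP.∷-injectiveʳ (allBoolVecs-unique n))
              (UniqueP.map⁺ VecP.∷-injectiveʳ (allBoolVecs-unique n)) disjoint
  where
  disjoint : ∀ {w} → w ∈ map (true ∷_) (allBoolVecs n) × w ∈ map (false ∷_) (allBoolVecs n) → ⊥
  disjoint (p , q) with ∈-map⁻ (true ∷_) p | ∈-map⁻ (false ∷_) q
  ... | _ , _ , refl | _ , _ , ()

module Bounds {n} (G : LGraph n) (v : Fin n) (m : ℕ) (Gv : label G v ≡ + suc m) where
  open Peeling G v

  components : List (Vec Bool n)
  components = vComponents G v

  decompositions : List (List (Vec Bool n))
  decompositions = filter (decompCond? G) (multisets (suc m) components)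

  ∈-components : ∀ {H} → VComponent G v H → H ∈ components
  ∈-components {H} c = ∈-filter⁺ (vComp? G v) (allBoolVecs-complete n H) c

  components-sound : ∀ {H} → H ∈ components → VComponent G v H
  components-sound p = proj₂ (∈-filter⁻ (vComp? G v) {xs = allBoolVecs n} p)

  components-unique : Unique components
  components-unique = UniqueP.filter⁺ (vComp? G v) (allBoolVecs-unique n)

  decompositions-size : ∀ {𝓗} → 𝓗 ∈ decompositions → length 𝓗 ≡ suc m
  decompositions-size p = multisets-length (suc m) components (proj₁ (∈-filter⁻ (decompCond? G) p))

  sorted-completion : ∀ H → VComponent G v H →
    ∃ λ 𝓗 → 𝓗 ∈ decompositions × 𝓗 ↭ completion m H
  sorted-completion H c =
    let all , residual , len = completion-decomposes Gv c
        𝓗 , 𝓗∈ , 𝓗↭ = multisets-sort components (completion m H) (All.map ∈-components all)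
    in  𝓗 , ∈-filter⁺ (decompCond? G) (subst (λ l → 𝓗 ∈ multisets l components) len 𝓗∈)
          (standard-≗ (λ i → cong (label G i -ℤ_) (sym (sumL-↭ 𝓗↭ i))) residual) , 𝓗↭

  -- Each component occurs in some decomposition, and each has suc m members;
  -- the relation used for counting is equality into the concatenation.
  lower-bound : length components ≤ suc m * length decompositions
  lower-bound = begin
    length components               ≤⟨ injection-length _≡_ components (concat decompositions)
                                          components-unique occurs ≡-injective ⟩
    length (concat decompositions)  ≡⟨ length-concat (suc m) decompositions decompositions-size ⟩
    length decompositions * suc m   ≡⟨ ℕP.*-comm (length decompositions) (suc m) ⟩
    suc m * length decompositions   ∎
    where
    open ℕP.≤-Reasoning
    occurs : ∀ {H} → H ∈ components → ∃ λ H′ → H′ ∈ concat decompositions × H ≡ H′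
    occurs {H} p =
      let 𝓗 , 𝓗∈ , 𝓗↭ = sorted-completion H (components-sound p)
      in  H , ∈-concat⁺′ (∈-resp-↭ (↭-sym 𝓗↭) (here refl)) 𝓗∈ , refl
    ≡-injective : ∀ {H H′ H″ : Vec Bool n} → H ≡ H″ → H′ ≡ H″ → H ≡ H′
    ≡-injective p q = trans p (sym q)

  upper-bound : length decompositions ≤ (length components + m) C suc m
  upper-bound = subst (length decompositions ≤_) (multisets-count (suc m) components)
    (ListP.length-filter (decompCond? G) (multisets (suc m) components))

  -- With v minimal, the completion of H is H followed by copies of supp G,
  -- so the decomposition containing it determines H.
  minimal-bound : MinPositive G v → length components ≤ length decompositions
  minimal-bound minpos = injection-length Completes components decompositions components-unique total injective
    where
    S : Vec Bool n
    S = support (label G)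
    Completes : Vec Bool n → List (Vec Bool n) → Set
    Completes H 𝓗 = 𝓗 ↭ (H ∷ replicate m S)
    total : ∀ {H} → H ∈ components → ∃ λ 𝓗 → 𝓗 ∈ decompositions × Completes H 𝓗
    total {H} p =
      let 𝓗 , 𝓗∈ , 𝓗↭ = sorted-completion H (components-sound p)
      in  𝓗 , 𝓗∈ , subst (𝓗 ↭_) flat 𝓗↭
      where
      flat : completion m H ≡ H ∷ replicate m S
      flat = cong (H ∷_) (peel-flat S m (residual-flat G v {H = H} minpos Gv (components-sound p)))
    injective : ∀ {H H′ 𝓗} → Completes H 𝓗 → Completes H′ 𝓗 → H ≡ H′
    injective c c′ with ∈-resp-↭ c′ (∈-resp-↭ (↭-sym c) (here refl))
                      | ∈-resp-↭ c (∈-resp-↭ (↭-sym c′) (here refl))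
    ... | here e  | _       = e
    ... | there q | here e  = sym e
    ... | there q | there q′ = trans (∈-replicate m q) (sym (∈-replicate m q′))

-- The hypothesis 1 ≤ l makes l = suc m.
proposition5p2 : (n : ℕ) (G : LGraph n) (v : Fin n) (l : ℕ) →
    Loopless (edges G) → Standard (edges G) (label G) →
    label G v ≡ + l → 1 ≤ l →
    let k = numVComponents G v
        d = numVDecompositions G v l
    in (k ≤ l * d × d ≤ (k + (l ∸ 1)) C l)
       × (MinPositive G v → k ≤ d)
proposition5p2 n G v (suc m) _ _ Gv (s≤s z≤n) = (lower-bound , upper-bound) , minimal-bound
  where open Bounds G v m Gv
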